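{- For all integers $m,n\ge 1$ with $(m,n)\ne(1,1)$, $$G_{m,n}(H,V)=H^m\sum_{r=0}^{n-2}\binom{r+m-1}{m-1}V^r+V^n\sum_{r=0}^{m-2}\binom{r+n-1}{n-1}H^r,$$ where $G_{m,n}(H,V)=\sum_{t} H^{h(t)}V^{v(t)}$, the sum running over all non-maximal spotlight tilings $t$ of the $m\times n$ rectangle, and $h(t)$, $v(t)$ are the numbers of horizontal and vertical spotlights in $t$.
   Context: A region is a finite set of unit squares of the square grid whose edge-adjacency graph is connected. A northwest corner of a region $R$ is a square of $R$ such that neither the square directly above it nor the square directly to its left belongs to $R$. A spotlight tiling of $R$ is produced recursively: choose a northwest corner $s$ of $R$ and place a spotlight with endpoint $s$, extending either east (a horizontal spotlight) or south (a vertical spotlight) as far as possible, i.e. consisting of $s$ together with the maximal run of consecutive squares of $R$ in that direction. The uncovered squares form a disjoint union of regions (connected components), each of which is then given a spotlight tiling recursively; the empty region has exactly one (empty) tiling. The spotlight tiling is the final collection of spotlights. Two spotlight tilings are the same if and only if they give the same collection of spotlights (order of placement is irrelevant). If the last spotlight placed has length $1$, it is called an HV-spotlight and is not assigned a direction. A spotlight tiling of the $m\times n$ rectangle is maximal if it uses the largest possible number of spotlights among spotlight tilings of that rectangle. In a non-maximal spotlight tiling of a rectangle there is no HV-spotlight, and each spotlight has a well-defined direction (horizontal or vertical, namely the direction in which it was placed). -}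

module Defs where

open import Data.Bool using (Bool; true; false; if_then_else_; _∧_; _∨_; not)
open import Data.Nat using (ℕ; zero; suc; _+_; _∸_; _≡ᵇ_; _<ᵇ_; _⊔_; pred)
open import Data.Nat.Combinatorics using (_C_)
open import Data.List using (List; []; _∷_; _++_; map; concatMap; filter; length; foldr; upTo)
open import Data.Bool.ListAction using (any; all)
open import Data.Nat.ListAction using (sum)
open import Data.Product using (_×_; _,_; proj₁; proj₂)
open import Relation.Nullary.Decidable using (T?)
open import Function using (_∘_)

-- Squares, regions
-- A square is (row , column); rows increase downwards ("south"),
-- columns increase to the right ("east").

Sq : Set
Sq = ℕ × ℕ

sqEq : Sq → Sq → Bool
sqEq (a , b) (c , d) = (a ≡ᵇ c) ∧ (b ≡ᵇ d)

-- A region is given by the (duplicate-free) list of its squares.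
Region : Set
Region = List Sq

_∈ᵇ_ : Sq → Region → Bool
s ∈ᵇ R = any (sqEq s) R

remove : Region → Region → Region
remove R S = filter (λ x → T? (not (x ∈ᵇ S))) R

isNW : Region → Sq → Bool
isNW R (i , j) =
  ((i ≡ᵇ 0) ∨ not ((pred i , j) ∈ᵇ R)) ∧ ((j ≡ᵇ 0) ∨ not ((i , pred j) ∈ᵇ R))

nwCorners : Region → List Sq
nwCorners R = filter (λ s → T? (isNW R s)) R

data Dir : Set where
  hor ver : Dir

step : Dir → Sq → Sq
step hor (i , j) = (i , suc j)
step ver (i , j) = (suc i , j)

run : ℕ → Region → Dir → Sq → List Sq
run zero    R d s = []
run (suc f) R d s = if s ∈ᵇ R then s ∷ run f R d (step d s) else []

record Spot : Set where
  constructor spot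
  field
    dir     : Dir
    squares : List Sq
open Spot public

place : Region → Dir → Sq → Spot
place R d s = spot d (run (length R) R d s)

adj : Sq → Sq → Bool
adj (a , b) (c , d) =
  ((a ≡ᵇ c) ∧ ((suc b ≡ᵇ d) ∨ (suc d ≡ᵇ b))) ∨
  ((b ≡ᵇ d) ∧ ((suc a ≡ᵇ c) ∨ (suc c ≡ᵇ a)))

expand : Region → List Sq → List Sq
expand R S = filter (λ y → T? ((y ∈ᵇ S) ∨ any (adj y) S)) R

closure : ℕ → Region → List Sq → List Sq
closure zero    R S = S
closure (suc f) R S = closure f R (expand R S)

components : ℕ → Region → List Region
components zero    R        = []
components (suc f) []       = []
components (suc f) (x ∷ R)  =
  let C = closure (length (x ∷ R)) (x ∷ R) (x ∷ [])
  in  C ∷ components f (remove (x ∷ R) C)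

-- All outcomes of the recursive spotlight process
-- (each outcome = list of placed spotlights; the same tiling may occur
-- several times, corresponding to different placement orders)

tilingsF : ℕ → Region → List (List Spot)
tilingsF zero    R       = []
tilingsF (suc f) []      = [] ∷ []
tilingsF (suc f) (x ∷ R) =
  concatMap (λ s → concatMap (λ d → go (place (x ∷ R) d s)) (hor ∷ ver ∷ []))
            (nwCorners (x ∷ R))
  where
  go : Spot → List (List Spot)
  go sp =
    let rest = remove (x ∷ R) (squares sp)
        cs   = components (suc (length rest)) rest
        combos = foldr (λ c acc → concatMap (λ t → map (t ++_) acc) (tilingsF f c))
                       ([] ∷ []) cs
    in map (sp ∷_) combos

-- Two tilings are the same iff they have the same collection of spotlights
-- (spotlights compared as sets of squares).
sqListEq : List Sq → List Sq → Bool
sqListEq []       []       = true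
sqListEq (x ∷ xs) (y ∷ ys) = sqEq x y ∧ sqListEq xs ys
sqListEq _        _        = false

sameTiling : List Spot → List Spot → Bool
sameTiling t u =
  all (λ a → any (λ b → sqListEq (squares a) (squares b)) u) t ∧
  all (λ b → any (λ a → sqListEq (squares a) (squares b)) t) u

dedup : List (List Spot) → List (List Spot) → List (List Spot)
dedup seen []       = seen
dedup seen (t ∷ ts) = if any (sameTiling t) seen then dedup seen ts else dedup (t ∷ seen) ts

tilings : Region → List (List Spot)
tilings R = dedup [] (tilingsF (suc (length R)) R)

rect : ℕ → ℕ → Region
rect m n = concatMap (λ i → map (i ,_) (upTo n)) (upTo m)

maxSpots : ℕ → ℕ → ℕ
maxSpots m n = foldr (λ t k → length t ⊔ k) 0 (tilings (rect m n))

nonMaximal : ℕ → ℕ → List (List Spot)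
nonMaximal m n = filter (λ t → T? (length t <ᵇ maxSpots m n)) (tilings (rect m n))

isHor isVer : Spot → Bool
isHor (spot hor _) = true
isHor (spot ver _) = false
isVer (spot hor _) = false
isVer (spot ver _) = true

hcount vcount : List Spot → ℕ
hcount t = length (filter (T? ∘ isHor) t)
vcount t = length (filter (T? ∘ isVer) t)

-- Polynomials in H, V with ℕ coefficients, as lists of monomials
-- (c , a , b) standing for c · H^a V^b

Poly : Set
Poly = List (ℕ × ℕ × ℕ)

coeff : Poly → ℕ → ℕ → ℕ
coeff P a b = sum (map (λ { (c , a' , b') → if (a ≡ᵇ a') ∧ (b ≡ᵇ b') then c else 0 }) P)

G : ℕ → ℕ → Poly
G m n = map (λ t → (1 , hcount t , vcount t)) (nonMaximal m n)

RHS : ℕ → ℕ → Poly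
RHS m n =
  map (λ r → ((r + (m ∸ 1)) C (m ∸ 1) , m , r)) (upTo (n ∸ 1)) ++
  map (λ r → ((r + (n ∸ 1)) C (n ∸ 1) , r , n)) (upTo (m ∸ 1))

module Submission where

-- A run of the spotlight process on a box (a rectangle) is forced at every step: the box
-- has a single northwest corner, its top-left square; a horizontal spotlight takes the
-- whole first row, a vertical one the whole first column; and the remainder is again a
-- box, which is connected.  So the runs on an m × n box are the words over {hor, ver}
-- that exhaust the rows or the columns, and such a word has at most m + n - 1 letters.
-- Two words give the same tiling only if they are equal or both of maximal length (the
-- first spotlights share the corner square, and a row equals a column only in a 1 × 1
-- box).  Hence maximal tilings have m + n - 1 spotlights, and the coefficient of H^a V^b
-- in G counts the non-maximal words with a letters hor and b letters ver.  That count
-- satisfies a first-letter recursion which, through Pascal's rule, yields the binomial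
-- coefficients of the right-hand side.

open import Defs
open import Data.Bool using (Bool; true; false; if_then_else_; _∧_; _∨_; not; T)
open import Data.Bool.Properties using (T-≡; T-∧; T-∨; T-not-≡; ∧-zeroʳ; ∧-identityʳ)
open import Data.Nat using (ℕ; _≟_; zero; suc; _+_; _*_; _∸_; _≡ᵇ_; _<ᵇ_; _⊔_; pred; _≤_; _<_; z≤n; s≤s; z<s)
open import Data.Nat.Properties
open import Data.List using (List; []; _∷_; _++_; map; concatMap; filter; length; foldr; upTo; applyUpTo)
open import Data.List.Properties using (∷-injective; length-++; map-++; map-∘; ++-identityʳ; concatMap-cong; concatMap-pure; filter-all; filter-none; filter-accept; filter-reject; filter-++)
open import Data.List.Relation.Unary.All as All using (All)
open import Data.List.Relation.Unary.Any as Any using (Any; here; there)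
open import Data.List.Relation.Unary.Any.Properties using (any⁺; any⁻)
open import Data.List.Relation.Unary.All.Properties using (all⁺; all⁻; All¬⇒¬Any)
open import Data.List.Relation.Unary.AllPairs using ([]; _∷_)
open import Data.List.Relation.Unary.Unique.Propositional using (Unique)
import Data.List.Relation.Unary.Unique.Propositional.Properties as Unique
open import Data.List.Relation.Binary.Disjoint.Propositional using (Disjoint)
open import Data.List.Membership.Propositional using (_∈_; _∉_; find)
open import Data.List.Membership.Propositional.Properties using (∈-++⁺ˡ; ∈-++⁺ʳ; ∈-++⁻; ∈-map⁺; ∈-map⁻; ∈-filter⁺)
open import Data.Product using (_×_; _,_; proj₁; proj₂; ∃-syntax)
open import Data.Sum using (_⊎_; inj₁; inj₂)
open import Data.Empty using (⊥-elim)
open import Data.Unit using (⊤; tt)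
open import Data.Nat.ListAction using (sum)
open import Data.Nat.Combinatorics using (_C_; nCn≡1; nCk+nC[k+1]≡[n+1]C[k+1])
open import Data.Bool.ListAction using (any; all)
open import Algebra.Properties.CommutativeSemigroup +-commutativeSemigroup using (interchange)
open import Function using (_∘_; Equivalence)
open import Relation.Nullary using (¬_; yes; no)
open import Relation.Nullary.Decidable using (T?)
open import Relation.Binary.PropositionalEquality

≡ᵇ-refl : ∀ n → (n ≡ᵇ n) ≡ true
≡ᵇ-refl n = Equivalence.to T-≡ (≡⇒≡ᵇ n n refl)

≢⇒≡ᵇ-false : ∀ {m n} → m ≢ n → (m ≡ᵇ n) ≡ false
≢⇒≡ᵇ-false {m} {n} m≢n with m ≡ᵇ n in eq
... | true  = ⊥-elim (m≢n (≡ᵇ⇒≡ m n (Equivalence.from T-≡ eq)))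
... | false = refl

sqEq⇒≡ : ∀ s t → T (sqEq s t) → s ≡ t
sqEq⇒≡ (a , b) (c , d) e with Equivalence.to T-∧ e
... | a≡c , b≡d = cong₂ _,_ (≡ᵇ⇒≡ a c a≡c) (≡ᵇ⇒≡ b d b≡d)

sqEq-refl : ∀ s → T (sqEq s s)
sqEq-refl (a , b) = Equivalence.from T-∧ (≡⇒≡ᵇ a a refl , ≡⇒≡ᵇ b b refl)

∈ᵇ⇒∈ : ∀ {s R} → (s ∈ᵇ R) ≡ true → s ∈ R
∈ᵇ⇒∈ {s} {R} e = Any.map (sqEq⇒≡ s _) (any⁻ (sqEq s) R (Equivalence.from T-≡ e))

∈⇒∈ᵇ : ∀ {s R} → s ∈ R → (s ∈ᵇ R) ≡ true
∈⇒∈ᵇ {s} m = Equivalence.to T-≡ (any⁺ (sqEq s) (Any.map (λ { refl → sqEq-refl s }) m))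

∉⇒∈ᵇ-false : ∀ {s R} → s ∉ R → (s ∈ᵇ R) ≡ false
∉⇒∈ᵇ-false {s} {R} s∉R with s ∈ᵇ R in eq
... | true  = ⊥-elim (s∉R (∈ᵇ⇒∈ eq))
... | false = refl

Between : ℕ → ℕ → ℕ → Set
Between j B y = j ≤ y × y < j + B

between-start : ∀ j B → Between j (suc B) j
between-start j B = ≤-refl , m<m+n j z<s

between-step : ∀ {j B y} → Between (suc j) B y → Between j (suc B) y
between-step {j} {B} {y} (j<y , y<1+j+B) = <⇒≤ j<y , subst (y <_) (sym (+-suc j B)) y<1+j+B

between-split : ∀ {j B y} → Between j (suc B) y → y ≡ j ⊎ Between (suc j) B y
between-split {j} {B} {y} (j≤y , y<j+1+B) with m≤n⇒m<n∨m≡n j≤y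
... | inj₂ refl = inj₁ refl
... | inj₁ j<y  = inj₂ (j<y , subst (y <_) (+-suc j B) y<j+1+B)

between-empty : ∀ {j y} → ¬ Between j 0 y
between-empty {j} {y} (j≤y , y<j+0) = <-irrefl refl (≤-<-trans j≤y (subst (y <_) (+-identityʳ j) y<j+0))

between-end : ∀ {j B} → ¬ Between j B (j + B)
between-end (_ , j+B<j+B) = <-irrefl refl j+B<j+B

between-pred : ∀ {j B y} → Between (suc j) B (suc y) → Between j (suc B) y
between-pred {j} {B} {y} (1+j≤1+y , 2+y≤1+j+B) =
  ≤-pred 1+j≤1+y , subst (y <_) (sym (+-suc j B)) (m<n⇒m<1+n (≤-pred 2+y≤1+j+B))

ray : Dir → Sq → ℕ → List Sq
ray d s zero    = []
ray d s (suc k) = s ∷ ray d (step d s) k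

shift : Dir → ℕ → Sq → Sq
shift d zero    s = s
shift d (suc k) s = shift d k (step d s)

shift-hor : ∀ k i j → shift hor k (i , j) ≡ (i , j + k)
shift-hor zero    i j = cong (i ,_) (sym (+-identityʳ j))
shift-hor (suc k) i j = trans (shift-hor k i (suc j)) (cong (i ,_) (sym (+-suc j k)))

shift-ver : ∀ k i j → shift ver k (i , j) ≡ (i + k , j)
shift-ver zero    i j = cong (_, j) (sym (+-identityʳ i))
shift-ver (suc k) i j = trans (shift-ver k (suc i) j) (cong (_, j) (sym (+-suc i k)))

row : ℕ → ℕ → ℕ → List Sq
row i j B = ray hor (i , j) B

col : ℕ → ℕ → ℕ → List Sq
col i A j = ray ver (i , j) A

box : ℕ → ℕ → ℕ → ℕ → Region
box i zero    j B = []
box i (suc A) j B = row i j B ++ box (suc i) A j B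

InBox : ℕ → ℕ → ℕ → ℕ → Sq → Set
InBox i A j B (x , y) = Between i A x × Between j B y

row-mem⁻ : ∀ {i j B x y} → (x , y) ∈ row i j B → x ≡ i × Between j B y
row-mem⁻ {j = j} {B = suc B} (here refl) = refl , between-start j B
row-mem⁻ {B = suc B} (there m) with row-mem⁻ m
... | refl , bt = refl , between-step bt

row-mem⁺ : ∀ {i j B y} → Between j B y → (i , y) ∈ row i j B
row-mem⁺ {B = zero}  bt = ⊥-elim (between-empty bt)
row-mem⁺ {B = suc B} bt with between-split bt
... | inj₁ refl = here refl
... | inj₂ bt'  = there (row-mem⁺ bt')

col-mem⁻ : ∀ {i A j x y} → (x , y) ∈ col i A j → y ≡ j × Between i A x
col-mem⁻ {i = i} {A = suc A} (here refl) = refl , between-start i A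
col-mem⁻ {A = suc A} (there m) with col-mem⁻ m
... | refl , bt = refl , between-step bt

col-mem⁺ : ∀ {i A j x} → Between i A x → (x , j) ∈ col i A j
col-mem⁺ {A = zero}  bt = ⊥-elim (between-empty bt)
col-mem⁺ {A = suc A} bt with between-split bt
... | inj₁ refl = here refl
... | inj₂ bt'  = there (col-mem⁺ bt')

box-mem⁻ : ∀ {i A j B x y} → (x , y) ∈ box i A j B → InBox i A j B (x , y)
box-mem⁻ {i} {suc A} {j} {B} m with ∈-++⁻ (row i j B) m
... | inj₁ r with row-mem⁻ r
...   | refl , by = between-start i A , by
box-mem⁻ {i} {suc A} m | inj₂ r with box-mem⁻ r
...   | bx , by = between-step bx , by

box-mem⁺ : ∀ {i A j B x y} → InBox i A j B (x , y) → (x , y) ∈ box i A j B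
box-mem⁺ {A = zero} (bx , _) = ⊥-elim (between-empty bx)
box-mem⁺ {i} {suc A} {j} {B} (bx , by) with between-split bx
... | inj₁ refl = ∈-++⁺ˡ (row-mem⁺ by)
... | inj₂ bx'  = ∈-++⁺ʳ (row i j B) (box-mem⁺ (bx' , by))

-- a box has A · B squares, which bounds the fuel the process needs
length-ray : ∀ d s k → length (ray d s k) ≡ k
length-ray d s zero    = refl
length-ray d s (suc k) = cong suc (length-ray d (step d s) k)

length-box : ∀ i A j B → length (box i A j B) ≡ A * B
length-box i zero    j B = refl
length-box i (suc A) j B = begin
  length (row i j B ++ box (suc i) A j B)
    ≡⟨ length-++ (row i j B) ⟩
  length (row i j B) + length (box (suc i) A j B)
    ≡⟨ cong₂ _+_ (length-ray hor (i , j) B) (length-box (suc i) A j B) ⟩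
  B + A * B
    ∎
  where open ≡-Reasoning

box-width0 : ∀ i A j → box i A j 0 ≡ []
box-width0 i zero    j = refl
box-width0 i (suc A) j = box-width0 (suc i) A j

row-upTo : ∀ i (f : ℕ → ℕ) k n → (∀ x → f x ≡ k + x) → map (i ,_) (applyUpTo f n) ≡ row i k n
row-upTo i f k zero    f≗k+ = refl
row-upTo i f k (suc n) f≗k+ rewrite f≗k+ 0 | +-identityʳ k =
  cong ((i , k) ∷_) (row-upTo i (f ∘ suc) (suc k) n (λ x → trans (f≗k+ (suc x)) (+-suc k x)))

rect-upTo : ∀ (f : ℕ → ℕ) k m n → (∀ x → f x ≡ k + x) →
            concatMap (λ i → map (i ,_) (upTo n)) (applyUpTo f m) ≡ box k m 0 n
rect-upTo f k zero    n f≗k+ = refl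
rect-upTo f k (suc m) n f≗k+ rewrite f≗k+ 0 | +-identityʳ k =
  cong₂ _++_ (row-upTo k (λ x → x) 0 n (λ x → refl))
             (rect-upTo (f ∘ suc) (suc k) m n (λ x → trans (f≗k+ (suc x)) (+-suc k x)))

rect≡box : ∀ m n → rect m n ≡ box 0 m 0 n
rect≡box m n = rect-upTo (λ x → x) 0 m n (λ x → refl)

run≡ray : ∀ R d s k f → k ≤ f → (∀ {x} → x ∈ ray d s k → x ∈ R) → shift d k s ∉ R →
          run f R d s ≡ ray d s k
run≡ray R d s zero    zero    _         _      _   = refl
run≡ray R d s zero    (suc f) _         _      out rewrite ∉⇒∈ᵇ-false out = refl
run≡ray R d s (suc k) (suc f) (s≤s k≤f) inside out rewrite ∈⇒∈ᵇ (inside (here refl)) =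
  cong (s ∷_) (run≡ray R d (step d s) k f k≤f (inside ∘ there) out)

free-side : ∀ k (inR : ℕ → Bool) → (∀ {k'} → k ≡ suc k' → inR k' ≡ false) →
            ((k ≡ᵇ 0) ∨ not (inR (pred k))) ≡ true
free-side zero    inR free = refl
free-side (suc k) inR free rewrite free refl = refl

isNW-up : ∀ {R x y} → (x , y) ∈ R → isNW R (suc x , y) ≡ false
isNW-up m rewrite ∈⇒∈ᵇ m = refl

isNW-left : ∀ {R x y} → (x , y) ∈ R → isNW R (x , suc y) ≡ false
isNW-left m rewrite ∈⇒∈ᵇ m = ∧-zeroʳ _

remove-prefix : ∀ P Q → (∀ {x} → x ∈ Q → x ∉ P) → remove (P ++ Q) P ≡ Q
remove-prefix P Q disjoint = begin
  filter keep? (P ++ Q)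
    ≡⟨ filter-++ keep? P Q ⟩
  filter keep? P ++ filter keep? Q
    ≡⟨ cong₂ _++_ (filter-none keep? (All.tabulate dropP)) (filter-all keep? (All.tabulate keepQ)) ⟩
  Q
    ∎
  where
  open ≡-Reasoning
  keep? = λ x → T? (not (x ∈ᵇ P))
  dropP : ∀ {x} → x ∈ P → ¬ T (not (x ∈ᵇ P))
  dropP m = subst (T ∘ not) (∈⇒∈ᵇ m)
  keepQ : ∀ {x} → x ∈ Q → T (not (x ∈ᵇ P))
  keepQ m = Equivalence.from T-not-≡ (∉⇒∈ᵇ-false (disjoint m))

remove-self : ∀ R → remove R R ≡ []
remove-self R = filter-none (λ x → T? (not (x ∈ᵇ R))) {xs = R} (All.tabulate (subst (T ∘ not) ∘ ∈⇒∈ᵇ))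

closure-suc : ∀ f R S → closure (suc f) R S ≡ expand R (closure f R S)
closure-suc zero    R S = refl
closure-suc (suc f) R S = closure-suc f R (expand R S)

adj-up : ∀ x y → T (adj (suc x , y) (x , y))
adj-up x y = Equivalence.from T-∨ (inj₂ (Equivalence.from T-∧
  (≡⇒≡ᵇ y y refl , Equivalence.from T-∨ (inj₂ (≡⇒≡ᵇ x x refl)))))

adj-left : ∀ x y → T (adj (x , suc y) (x , y))
adj-left x y = Equivalence.from T-∨ (inj₁ (Equivalence.from T-∧
  (≡⇒≡ᵇ x x refl , Equivalence.from T-∨ (inj₂ (≡⇒≡ᵇ y y refl)))))

remove-first-col : ∀ S i A j B →
  (∀ {x y} → (x , y) ∈ box i A j (suc B) → ((x , y) ∈ᵇ S) ≡ (y ≡ᵇ j)) →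
  remove (box i A j (suc B)) S ≡ box i A (suc j) B
remove-first-col S i zero    j B onCol = refl
remove-first-col S i (suc A) j B onCol = begin
  filter keep? ((i , j) ∷ row i (suc j) B ++ box (suc i) A j (suc B))
    ≡⟨ filter-reject keep? (subst (T ∘ not) (trans (onCol (here refl)) (≡ᵇ-refl j))) ⟩
  filter keep? (row i (suc j) B ++ box (suc i) A j (suc B))
    ≡⟨ filter-++ keep? (row i (suc j) B) (box (suc i) A j (suc B)) ⟩
  filter keep? (row i (suc j) B) ++ filter keep? (box (suc i) A j (suc B))
    ≡⟨ cong₂ _++_ (filter-all keep? (All.tabulate keep-row))
                  (remove-first-col S (suc i) A j B (onCol ∘ ∈-++⁺ʳ (row i j (suc B)))) ⟩
  row i (suc j) B ++ box (suc i) A (suc j) B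
    ∎
  where
  open ≡-Reasoning
  keep? = λ x → T? (not (x ∈ᵇ S))
  keep-row : ∀ {s} → s ∈ row i (suc j) B → T (not (s ∈ᵇ S))
  keep-row {x , y} r with row-mem⁻ r
  ... | refl , (j<y , _) = Equivalence.from T-not-≡
    (trans (onCol (there (∈-++⁺ˡ r))) (≢⇒≡ᵇ-false {y} {j} (λ { refl → <-irrefl refl j<y })))

components-empty : ∀ f → components f [] ≡ []
components-empty zero    = refl
components-empty (suc f) = refl

grows : ∀ S {s} → (s ∈ S ⊎ ∃[ s' ] (s' ∈ S × T (adj s s'))) → T ((s ∈ᵇ S) ∨ any (adj s) S)
grows S (inj₁ s∈S) = Equivalence.from T-∨ (inj₁ (Equivalence.from T-≡ (∈⇒∈ᵇ s∈S)))
grows S {s} (inj₂ (s' , s'∈S , s~s')) =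
  Equivalence.from T-∨ (inj₂ (any⁺ (adj s) (Any.map (λ { refl → s~s' }) s'∈S)))

module NonemptyBox (i A j B : ℕ) where

  R : Region
  R = box i (suc A) j (suc B)

  -- membership in R, specialised so that the box parameters are not left to inference
  inR⁻ : ∀ {x y} → (x , y) ∈ R → InBox i (suc A) j (suc B) (x , y)
  inR⁻ = box-mem⁻ {i} {suc A} {j} {suc B}

  inR⁺ : ∀ {x y} → InBox i (suc A) j (suc B) (x , y) → (x , y) ∈ R
  inR⁺ = box-mem⁺ {i} {suc A} {j} {suc B}

  place-hor : place R hor (i , j) ≡ spot hor (row i j (suc B))
  place-hor = cong (spot hor) (run≡ray R hor (i , j) (suc B) (length R) fuel ∈-++⁺ˡ out)
    where
    fuel : suc B ≤ length R
    fuel rewrite length-box i (suc A) j (suc B) = m≤m+n (suc B) (A * suc B)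
    out : shift hor (suc B) (i , j) ∉ R
    out rewrite shift-hor (suc B) i j = between-end ∘ proj₂ ∘ inR⁻

  place-ver : place R ver (i , j) ≡ spot ver (col i (suc A) j)
  place-ver = cong (spot ver) (run≡ray R ver (i , j) (suc A) (length R) fuel inside out)
    where
    fuel : suc A ≤ length R
    fuel rewrite length-box i (suc A) j (suc B) = m≤m*n (suc A) (suc B)
    inside : ∀ {s} → s ∈ col i (suc A) j → s ∈ R
    inside {x , y} m with col-mem⁻ m
    ... | refl , bx = inR⁺ (bx , between-start j B)
    out : shift ver (suc A) (i , j) ∉ R
    out rewrite shift-ver (suc A) i j = between-end ∘ proj₁ ∘ inR⁻

  -- every other square has a neighbour above or to the left in R
  nw-corners : nwCorners R ≡ (i , j) ∷ []
  nw-corners = trans (filter-accept nw? corner-nw) (cong ((i , j) ∷_) (filter-none nw? (All.tabulate other)))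
    where
    nw? = λ s → T? (isNW R s)
    above-free : ∀ {x} → i ≡ suc x → (x , j) ∉ R
    above-free refl m = <-irrefl refl (proj₁ (proj₁ (inR⁻ m)))
    left-free : ∀ {y} → j ≡ suc y → (i , y) ∉ R
    left-free refl m = <-irrefl refl (proj₁ (proj₂ (inR⁻ m)))
    corner-nw : T (isNW R (i , j))
    corner-nw = Equivalence.from T-≡ (cong₂ _∧_
      (free-side i (λ x → (x , j) ∈ᵇ R) (λ {x} e → ∉⇒∈ᵇ-false {x , j} {R} (above-free e)))
      (free-side j (λ y → (i , y) ∈ᵇ R) (λ {y} e → ∉⇒∈ᵇ-false {i , y} {R} (left-free e))))
    not-nw : ∀ s → isNW R s ≡ false → ¬ T (isNW R s)
    not-nw s e = subst T e
    other : ∀ {s} → s ∈ row i (suc j) B ++ box (suc i) A j (suc B) → ¬ T (isNW R s)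
    other {x , y} m with ∈-++⁻ (row i (suc j) B) m
    other {x , zero}   m | inj₁ r with row-mem⁻ r
    ... | _    , () , _
    other {x , suc y'} m | inj₁ r with row-mem⁻ r
    ... | refl , by = not-nw (x , suc y') (isNW-left (inR⁺ (between-start i A , between-pred by)))
    other {zero , y}   m | inj₂ r with box-mem⁻ {suc i} {A} {j} {suc B} r
    ... | () , _ , _
    other {suc x' , y} m | inj₂ r with box-mem⁻ {suc i} {A} {j} {suc B} r
    ... | bx , by = not-nw (suc x' , y) (isNW-up (inR⁺ (between-pred bx , by)))

  remove-row : remove R (row i j (suc B)) ≡ box (suc i) A j (suc B)
  remove-row = remove-prefix (row i j (suc B)) (box (suc i) A j (suc B)) disjoint
    where
    disjoint : ∀ {s} → s ∈ box (suc i) A j (suc B) → s ∉ row i j (suc B)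
    disjoint {x , y} m r with box-mem⁻ {suc i} {A} {j} {suc B} m | row-mem⁻ r
    ... | (i<x , _) , _ | refl , _ = <-irrefl refl i<x

  remove-col : remove R (col i (suc A) j) ≡ box i (suc A) (suc j) B
  remove-col = remove-first-col (col i (suc A) j) i (suc A) j B on-col
    where
    on-col : ∀ {x y} → (x , y) ∈ R → ((x , y) ∈ᵇ col i (suc A) j) ≡ (y ≡ᵇ j)
    on-col {x} {y} m with y ≟ j
    ... | yes refl = trans (∈⇒∈ᵇ (col-mem⁺ {i} {suc A} {j} (proj₁ (inR⁻ m)))) (sym (≡ᵇ-refl j))
    ... | no y≢j   = trans (∉⇒∈ᵇ-false {x , y} {col i (suc A) j} (y≢j ∘ proj₁ ∘ col-mem⁻ {i} {suc A} {j}))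
                           (sym (≢⇒≡ᵇ-false {y} {j} y≢j))

  -- connectedness: the closure of the corner reaches every square, by induction on
  -- the taxicab distance to the corner
  dist : Sq → ℕ
  dist (x , y) = (x ∸ i) + (y ∸ j)

  corner-dist : dist (i , j) ≡ 0
  corner-dist = cong₂ _+_ (n∸n≡0 i) (n∸n≡0 j)

  toward-corner : ∀ {s} → s ∈ R →
    s ≡ (i , j) ⊎ ∃[ s' ] (s' ∈ R × T (adj s s') × suc (dist s') ≡ dist s)
  toward-corner {x , y} m with between-split (proj₁ (inR⁻ m)) | between-split (proj₂ (inR⁻ m))
  ... | inj₁ refl | inj₁ refl = inj₁ refl
  toward-corner {x , zero}  m | inj₁ refl | inj₂ (() , _)
  toward-corner {x , suc y} m | inj₁ refl | inj₂ by@(j<1+y , _) =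
    inj₂ ((x , y) , inR⁺ (proj₁ (inR⁻ m) , between-pred by) , adj-left x y ,
          trans (sym (+-suc (x ∸ i) (y ∸ j))) (cong ((x ∸ i) +_) (sym (+-∸-assoc 1 (≤-pred j<1+y)))))
  toward-corner {zero , y}  m | inj₂ (() , _) | _
  toward-corner {suc x , y} m | inj₂ bx@(i<1+x , _) | _ =
    inj₂ ((x , y) , inR⁺ (between-pred bx , proj₂ (inR⁻ m)) , adj-up x y ,
          cong (_+ (y ∸ j)) (sym (+-∸-assoc 1 (≤-pred i<1+x))))

  Reached : ℕ → List Sq → Set
  Reached k S = ∀ {s} → s ∈ R → dist s ≤ k → s ∈ S

  reached-step : ∀ {k S} → Reached k S → Reached (suc k) (expand R S)
  reached-step {k} {S} reached {s} m d≤1+k = ∈-filter⁺ (λ y → T? ((y ∈ᵇ S) ∨ any (adj y) S)) m (grows S near)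
    where
    near : s ∈ S ⊎ ∃[ s' ] (s' ∈ S × T (adj s s'))
    near with toward-corner m
    ... | inj₁ refl = inj₁ (reached m (subst (_≤ k) (sym corner-dist) z≤n))
    ... | inj₂ (s' , m' , s~s' , e) = inj₂ (s' , reached m' (≤-pred (subst (_≤ suc k) (sym e) d≤1+k)) , s~s')

  reached-closure : ∀ f → Reached f (closure f R ((i , j) ∷ []))
  reached-closure zero m d≤0 with toward-corner m
  ... | inj₁ refl = here refl
  ... | inj₂ (_ , _ , _ , e) with subst (_≤ 0) (sym e) d≤0
  ...   | ()
  reached-closure (suc f) m d =
    subst (_ ∈_) (sym (closure-suc f R ((i , j) ∷ []))) (reached-step (reached-closure f) m d)

  -- distances are at most A + B, fewer than the squares of R other than the corner
  dist-bound : ∀ {s} → s ∈ R → dist s ≤ A + B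
  dist-bound m = +-mono-≤ (offset (proj₁ (inR⁻ m))) (offset (proj₂ (inR⁻ m)))
    where
    offset : ∀ {k K z} → Between k (suc K) z → z ∸ k ≤ K
    offset {k} {K} {z} (_ , z<k+1+K) = subst (z ∸ k ≤_) (m+n∸m≡n k K)
      (∸-monoˡ-≤ k (≤-pred (subst (suc z ≤_) (+-suc k K) z<k+1+K)))

  closure-box : closure (length R) R ((i , j) ∷ []) ≡ R
  closure-box = trans (closure-suc L R ((i , j) ∷ []))
    (filter-all (λ y → T? ((y ∈ᵇ S) ∨ any (adj y) S)) (All.tabulate (grows S ∘ inj₁ ∘ reached)))
    where
    L = length (row i (suc j) B ++ box (suc i) A j (suc B))
    S = closure L R ((i , j) ∷ [])
    A+B≤L : A + B ≤ L
    A+B≤L rewrite suc-injective (length-box i (suc A) j (suc B)) =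
      subst (_≤ B + A * suc B) (+-comm B A) (+-monoʳ-≤ B (m≤m*n A (suc B)))
    reached : ∀ {s} → s ∈ R → s ∈ S
    reached m = reached-closure L m (≤-trans (dist-bound m) A+B≤L)

  components-box : ∀ f → components (suc f) R ≡ R ∷ []
  components-box f = cong₂ _∷_ closure-box (begin
    components f (remove R (closure (length R) R ((i , j) ∷ [])))
      ≡⟨ cong (components f ∘ remove R) closure-box ⟩
    components f (remove R R)
      ≡⟨ cong (components f) (remove-self R) ⟩
    components f []
      ≡⟨ components-empty f ⟩
    []
      ∎)
    where open ≡-Reasoning

Tiling : Set
Tiling = List Spot

-- a word over {hor, ver} records which side of the remaining box each spotlight takes;
-- paths A B lists the complete words for an A × B box
paths : ℕ → ℕ → List (List Dir)
paths zero    B       = [] ∷ []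
paths (suc A) zero    = [] ∷ []
paths (suc A) (suc B) = map (hor ∷_) (paths A (suc B)) ++ map (ver ∷_) (paths (suc A) B)

spotsOf : ℕ → ℕ → ℕ → ℕ → List Dir → Tiling
spotsOf i (suc A) j (suc B) (hor ∷ p) = spot hor (row i j (suc B)) ∷ spotsOf (suc i) A j (suc B) p
spotsOf i (suc A) j (suc B) (ver ∷ p) = spot ver (col i (suc A) j) ∷ spotsOf i (suc A) (suc j) B p
spotsOf i A       j B       _         = []

-- the body of tilingsF: tile every component left after placing sp, and combine;
-- tilingsF (suc f) (x ∷ R) unfolds to the outcomes afterPlacing f (x ∷ R) of all first placements
combine : ℕ → Region → List Tiling
combine f rest = foldr (λ c acc → concatMap (λ t → map (t ++_) acc) (tilingsF f c)) ([] ∷ [])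
                       (components (suc (length rest)) rest)

afterPlacing : ℕ → Region → Spot → List Tiling
afterPlacing f R sp = map (sp ∷_) (combine f (remove R (squares sp)))

-- a box is connected, so combining over its components is just tiling it
combine-box : ∀ f i A j B → 1 ≤ f → combine f (box i A j B) ≡ tilingsF f (box i A j B)
combine-box (suc f) i zero    j B       _ = refl
combine-box (suc f) i (suc A) j zero    _ rewrite box-width0 i (suc A) j = refl
combine-box (suc f) i (suc A) j (suc B) _ =
  trans (cong (foldr (λ c acc → concatMap (λ t → map (t ++_) acc) (tilingsF (suc f) c)) ([] ∷ []))
              (NonemptyBox.components-box i A j B (length (box i (suc A) j (suc B)))))
        (trans (concatMap-cong (λ t → cong (_∷ []) (++-identityʳ t)) (tilingsF (suc f) (box i (suc A) j (suc B))))
               (concatMap-pure (tilingsF (suc f) (box i (suc A) j (suc B)))))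

tilings-step : ∀ f i A j B → 1 ≤ f → tilingsF (suc f) (box i (suc A) j (suc B)) ≡
  map (spot hor (row i j (suc B)) ∷_) (tilingsF f (box (suc i) A j (suc B))) ++
  map (spot ver (col i (suc A) j) ∷_) (tilingsF f (box i (suc A) (suc j) B))
tilings-step f i A j B 1≤f = begin
  tilingsF (suc f) R
    ≡⟨ cong (concatMap branches) nw-corners ⟩
  concatMap branches ((i , j) ∷ [])
    ≡⟨ trans (++-identityʳ _) (cong (afterPlacing f R (place R hor (i , j)) ++_) (++-identityʳ _)) ⟩
  afterPlacing f R (place R hor (i , j)) ++ afterPlacing f R (place R ver (i , j))
    ≡⟨ cong₂ (λ h v → afterPlacing f R h ++ afterPlacing f R v) place-hor place-ver ⟩
  map (sH ∷_) (combine f (remove R (row i j (suc B)))) ++ map (sV ∷_) (combine f (remove R (col i (suc A) j)))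
    ≡⟨ cong₂ (λ h v → map (sH ∷_) (combine f h) ++ map (sV ∷_) (combine f v)) remove-row remove-col ⟩
  map (sH ∷_) (combine f (box (suc i) A j (suc B))) ++ map (sV ∷_) (combine f (box i (suc A) (suc j) B))
    ≡⟨ cong₂ (λ h v → map (sH ∷_) h ++ map (sV ∷_) v)
             (combine-box f (suc i) A j (suc B) 1≤f) (combine-box f i (suc A) (suc j) B 1≤f) ⟩
  map (sH ∷_) (tilingsF f (box (suc i) A j (suc B))) ++ map (sV ∷_) (tilingsF f (box i (suc A) (suc j) B))
    ∎
  where
  open ≡-Reasoning
  open NonemptyBox i A j B
  sH = spot hor (row i j (suc B))
  sV = spot ver (col i (suc A) j)
  branches : Sq → List Tiling
  branches s = concatMap (λ d → afterPlacing f R (place R d s)) (hor ∷ ver ∷ [])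

tilings-box : ∀ f i A j B → suc (A * B) ≤ f → tilingsF f (box i A j B) ≡ map (spotsOf i A j B) (paths A B)
tilings-box (suc f) i zero    j B       _ = refl
tilings-box (suc f) i (suc A) j zero    _ rewrite box-width0 i (suc A) j = refl
tilings-box (suc f) i (suc A) j (suc B) (s≤s fuel) = begin
  tilingsF (suc f) (box i (suc A) j (suc B))
    ≡⟨ tilings-step f i A j B (≤-trans (s≤s z≤n) fuel) ⟩
  map (sH ∷_) (tilingsF f (box (suc i) A j (suc B))) ++ map (sV ∷_) (tilingsF f (box i (suc A) (suc j) B))
    ≡⟨ cong₂ (λ h v → map (sH ∷_) h ++ map (sV ∷_) v)
             (tilings-box f (suc i) A j (suc B) fuelH) (tilings-box f i (suc A) (suc j) B fuelV) ⟩
  map (sH ∷_) (map sp₁ (paths A (suc B))) ++ map (sV ∷_) (map sp₂ (paths (suc A) B))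
    ≡⟨ sym (cong₂ _++_ (map-∘ (paths A (suc B))) (map-∘ (paths (suc A) B))) ⟩
  map (spotsOf i (suc A) j (suc B) ∘ (hor ∷_)) (paths A (suc B)) ++
  map (spotsOf i (suc A) j (suc B) ∘ (ver ∷_)) (paths (suc A) B)
    ≡⟨ cong₂ _++_ (map-∘ (paths A (suc B))) (map-∘ (paths (suc A) B)) ⟩
  map (spotsOf i (suc A) j (suc B)) (map (hor ∷_) (paths A (suc B))) ++
  map (spotsOf i (suc A) j (suc B)) (map (ver ∷_) (paths (suc A) B))
    ≡⟨ sym (map-++ (spotsOf i (suc A) j (suc B)) (map (hor ∷_) (paths A (suc B))) _) ⟩
  map (spotsOf i (suc A) j (suc B)) (paths (suc A) (suc B))
    ∎
  where
  open ≡-Reasoning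
  sH = spot hor (row i j (suc B))
  sV = spot ver (col i (suc A) j)
  sp₁ = spotsOf (suc i) A j (suc B)
  sp₂ = spotsOf i (suc A) (suc j) B
  fuelH : suc (A * suc B) ≤ f
  fuelH = ≤-trans (s≤s (m≤n+m (A * suc B) B)) fuel
  fuelV : suc (suc A * B) ≤ f
  fuelV = ≤-trans (s≤s (+-monoʳ-≤ B (*-monoʳ-≤ A (n≤1+n B)))) fuel

tilings-rect : ∀ m n → tilings (rect m n) ≡ dedup [] (map (spotsOf 0 m 0 n) (paths m n))
tilings-rect m n rewrite rect≡box m n =
  cong (dedup []) (tilings-box (suc (length (box 0 m 0 n))) 0 m 0 n (s≤s (≤-reflexive (sym (length-box 0 m 0 n)))))

data Word : ℕ → ℕ → List Dir → Set where
  no-rows  : ∀ {B} → Word zero B []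
  no-cols  : ∀ {A} → Word (suc A) zero []
  take-row : ∀ {A B p} → Word A (suc B) p → Word (suc A) (suc B) (hor ∷ p)
  take-col : ∀ {A B p} → Word (suc A) B p → Word (suc A) (suc B) (ver ∷ p)

word⁻ : ∀ {A B p} → p ∈ paths A B → Word A B p
word⁻ {zero}          (here refl) = no-rows
word⁻ {suc A} {zero}  (here refl) = no-cols
word⁻ {suc A} {suc B} m with ∈-++⁻ (map (hor ∷_) (paths A (suc B))) m
... | inj₁ h with ∈-map⁻ (hor ∷_) h
...   | p , m' , refl = take-row (word⁻ m')
word⁻ {suc A} {suc B} m | inj₂ v with ∈-map⁻ (ver ∷_) v
...   | p , m' , refl = take-col (word⁻ m')

word⁺ : ∀ {A B p} → Word A B p → p ∈ paths A B
word⁺ no-rows      = here refl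
word⁺ no-cols      = here refl
word⁺ (take-row w) = ∈-++⁺ˡ (∈-map⁺ (hor ∷_) (word⁺ w))
word⁺ (take-col {A} {B} w) = ∈-++⁺ʳ (map (hor ∷_) (paths A (suc B))) (∈-map⁺ (ver ∷_) (word⁺ w))

#hor #ver : List Dir → ℕ
#hor []        = 0
#hor (hor ∷ p) = suc (#hor p)
#hor (ver ∷ p) = #hor p
#ver []        = 0
#ver (hor ∷ p) = #ver p
#ver (ver ∷ p) = suc (#ver p)

length≡#hor+#ver : ∀ p → length p ≡ #hor p + #ver p
length≡#hor+#ver []        = refl
length≡#hor+#ver (hor ∷ p) = cong suc (length≡#hor+#ver p)
length≡#hor+#ver (ver ∷ p) = trans (cong suc (length≡#hor+#ver p)) (sym (+-suc (#hor p) (#ver p)))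

spots-length : ∀ {i A j B p} → Word A B p → length (spotsOf i A j B p) ≡ length p
spots-length no-rows      = refl
spots-length no-cols      = refl
spots-length (take-row w) = cong suc (spots-length w)
spots-length (take-col w) = cong suc (spots-length w)

spots-hcount : ∀ {i A j B p} → Word A B p → hcount (spotsOf i A j B p) ≡ #hor p
spots-hcount no-rows      = refl
spots-hcount no-cols      = refl
spots-hcount (take-row w) = cong suc (spots-hcount w)
spots-hcount (take-col w) = spots-hcount w

spots-vcount : ∀ {i A j B p} → Word A B p → vcount (spotsOf i A j B p) ≡ #ver p
spots-vcount no-rows      = refl
spots-vcount no-cols      = refl
spots-vcount (take-row w) = spots-vcount w
spots-vcount (take-col w) = cong suc (spots-vcount w)

maxLen : ℕ → ℕ → ℕ
maxLen A B = A + B ∸ 1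

maxLen-row : ∀ A B → maxLen (suc A) (suc B) ≡ suc (maxLen A (suc B))
maxLen-row A B rewrite +-suc A B = refl

maxLen-col : ∀ A B → maxLen (suc A) (suc B) ≡ suc (maxLen (suc A) B)
maxLen-col A B = +-suc A B

word-length≤ : ∀ {A B p} → Word A B p → length p ≤ maxLen A B
word-length≤ no-rows = z≤n
word-length≤ no-cols = z≤n
word-length≤ (take-row {A} {B} {p} w) = subst (length (hor ∷ p) ≤_) (sym (maxLen-row A B)) (s≤s (word-length≤ w))
word-length≤ (take-col {A} {B} {p} w) = subst (length (ver ∷ p) ≤_) (sym (maxLen-col A B)) (s≤s (word-length≤ w))

longest-word : ∀ A B → ∃[ p ] (Word (suc A) (suc B) p × length p ≡ maxLen (suc A) (suc B))
longest-word zero    zero    = hor ∷ [] , take-row no-rows , refl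
longest-word (suc A) B       with longest-word A B
... | p , w , len = hor ∷ p , take-row w , trans (cong suc len) (sym (maxLen-row (suc A) B))
longest-word zero    (suc B) with longest-word zero B
... | p , w , len = ver ∷ p , take-col w , trans (cong suc len) (sym (maxLen-col zero (suc B)))

sqListEq⇒≡ : ∀ xs ys → T (sqListEq xs ys) → xs ≡ ys
sqListEq⇒≡ []       []       _ = refl
sqListEq⇒≡ (x ∷ xs) (y ∷ ys) e with Equivalence.to T-∧ e
... | x≈y , xs≈ys = cong₂ _∷_ (sqEq⇒≡ x y x≈y) (sqListEq⇒≡ xs ys xs≈ys)

sqListEq-refl : ∀ xs → T (sqListEq xs xs)
sqListEq-refl []       = tt
sqListEq-refl (x ∷ xs) = Equivalence.from T-∧ (sqEq-refl x , sqListEq-refl xs)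

self-match : ∀ (r : Spot → Spot → Bool) → (∀ a → T (r a a)) → ∀ t → T (all (λ a → any (r a) t) t)
self-match r r-refl t =
  all⁻ (λ a → any (r a) t) {xs = t} (All.tabulate (λ {a} m → any⁺ {xs = t} (r a) (Any.map (λ { refl → r-refl a }) m)))

sameTiling-refl : ∀ t → T (sameTiling t t)
sameTiling-refl t = Equivalence.from T-∧
  ( self-match (λ a b → sqListEq (squares a) (squares b)) (sqListEq-refl ∘ squares) t
  , self-match (λ b a → sqListEq (squares a) (squares b)) (sqListEq-refl ∘ squares) t)

Covers : Tiling → Tiling → Set
Covers t u = All (λ a → Any (λ b → squares a ≡ squares b) u) t

same⇒covers : ∀ t u → T (sameTiling t u) → Covers t u
same⇒covers t u same = All.map (λ {a} → Any.map (λ {b} → sqListEq⇒≡ (squares a) (squares b)) ∘ any⁻ _ u)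
  (all⁺ (λ a → any (λ b → sqListEq (squares a) (squares b)) u) t (proj₁ (Equivalence.to T-∧ same)))

StartsAt : Sq → Spot → Set
StartsAt c a = ∃[ r ] (squares a ≡ c ∷ r)

unmatched : ∀ {c a u} → (∀ {b} → b ∈ u → ¬ StartsAt c b) → StartsAt c a →
            ¬ Any (λ b → squares a ≡ squares b) u
unmatched away (r , a-at-c) (here e) = away (here refl) (r , trans (sym e) a-at-c)
unmatched {c} {a} {_ ∷ u} away a-at-c (there m) = unmatched {c} {a} {u} (away ∘ there) a-at-c m

covers-cons : ∀ {c sp₁ sp₂ t u} → StartsAt c sp₁ → StartsAt c sp₂ →
  (∀ {a} → a ∈ t → ¬ StartsAt c a) → (∀ {b} → b ∈ u → ¬ StartsAt c b) →
  Covers (sp₁ ∷ t) (sp₂ ∷ u) → squares sp₁ ≡ squares sp₂ × Covers t u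
covers-cons {c} {sp₁} {sp₂} {t} {u} sp₁-at-c (r₂ , sp₂-at-c) away-t away-u (first All.∷ rest) =
  head-match first , All.tabulate tail-match
  where
  head-match : Any (λ b → squares sp₁ ≡ squares b) (sp₂ ∷ u) → squares sp₁ ≡ squares sp₂
  head-match (here e)  = e
  head-match (there m) = ⊥-elim (unmatched {c} {sp₁} {u} away-u sp₁-at-c m)
  tail-match : ∀ {a} → a ∈ t → Any (λ b → squares a ≡ squares b) u
  tail-match m with All.lookup rest m
  ... | here e   = ⊥-elim (away-t m (r₂ , trans e sp₂-at-c))
  ... | there m' = m'

spots-start : ∀ {i A j B p a} → a ∈ spotsOf i A j B p →
              ∃[ x ] ∃[ y ] (StartsAt (x , y) a × i ≤ x × j ≤ y)
spots-start {i} {suc A} {j} {suc B} {hor ∷ p} (here refl) = i , j , (_ , refl) , ≤-refl , ≤-refl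
spots-start {i} {suc A} {j} {suc B} {ver ∷ p} (here refl) = i , j , (_ , refl) , ≤-refl , ≤-refl
spots-start {i} {suc A} {j} {suc B} {hor ∷ p} (there m) with spots-start m
... | x , y , at , i<x , j≤y = x , y , at , <⇒≤ i<x , j≤y
spots-start {i} {suc A} {j} {suc B} {ver ∷ p} (there m) with spots-start m
... | x , y , at , i≤x , j<y = x , y , at , i≤x , <⇒≤ j<y

away-below : ∀ {i A j B p a} → a ∈ spotsOf (suc i) A j B p → ¬ StartsAt (i , j) a
away-below m (r , at) with spots-start m
... | x , y , (r' , at') , i<x , _ with trans (sym at) at'
...   | refl = <-irrefl refl i<x

away-right : ∀ {i A j B p a} → a ∈ spotsOf i A (suc j) B p → ¬ StartsAt (i , j) a
away-right m (r , at) with spots-start m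
... | x , y , (r' , at') , _ , j<y with trans (sym at) at'
...   | refl = <-irrefl refl j<y

row≡col⇒unit : ∀ {i A j B p q} → Word A (suc B) p → Word (suc A) B q → row i j (suc B) ≡ col i (suc A) j →
               suc (length p) ≡ maxLen (suc A) (suc B) × suc (length q) ≡ maxLen (suc A) (suc B)
row≡col⇒unit {A = zero}  {B = zero}  no-rows no-cols _ = refl , refl
row≡col⇒unit {A = zero}  {B = suc B} _ _ ()
row≡col⇒unit {A = suc A} {B = zero}  _ _ ()
row≡col⇒unit {A = suc A} {B = suc B} _ _ ()

same-words : ∀ {i A j B p q} → Word A B p → Word A B q → Covers (spotsOf i A j B p) (spotsOf i A j B q) →
             p ≡ q ⊎ (length p ≡ maxLen A B × length q ≡ maxLen A B)
same-words no-rows no-rows _ = inj₁ refl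
same-words no-cols no-cols _ = inj₁ refl
same-words {i} {suc A} {j} {suc B} (take-row w) (take-row w') c
  with same-words w w' (proj₂ (covers-cons (_ , refl) (_ , refl) away-below away-below c))
... | inj₁ refl         = inj₁ refl
... | inj₂ (max , max') = inj₂ (lengthen max , lengthen max')
  where lengthen : ∀ {n} → n ≡ maxLen A (suc B) → suc n ≡ maxLen (suc A) (suc B)
        lengthen e = trans (cong suc e) (sym (maxLen-row A B))
same-words {i} {suc A} {j} {suc B} (take-col w) (take-col w') c
  with same-words w w' (proj₂ (covers-cons (_ , refl) (_ , refl) away-right away-right c))
... | inj₁ refl         = inj₁ refl
... | inj₂ (max , max') = inj₂ (lengthen max , lengthen max')
  where lengthen : ∀ {n} → n ≡ maxLen (suc A) B → suc n ≡ maxLen (suc A) (suc B)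
        lengthen e = trans (cong suc e) (sym (maxLen-col A B))
same-words (take-row w) (take-col w') c =
  inj₂ (row≡col⇒unit w w' (proj₁ (covers-cons (_ , refl) (_ , refl) away-below away-right c)))
same-words (take-col w) (take-row w') c with
  row≡col⇒unit w' w (sym (proj₁ (covers-cons (_ , refl) (_ , refl) away-right away-below c)))
... | max' , max = inj₂ (max , max')

dedup-⊆ : ∀ seen xs {t} → t ∈ dedup seen xs → t ∈ seen ⊎ t ∈ xs
dedup-⊆ seen []       m = inj₁ m
dedup-⊆ seen (x ∷ xs) m with any (sameTiling x) seen
... | true with dedup-⊆ seen xs m
...   | inj₁ t∈seen = inj₁ t∈seen
...   | inj₂ t∈xs   = inj₂ (there t∈xs)
dedup-⊆ seen (x ∷ xs) m | false with dedup-⊆ (x ∷ seen) xs m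
...   | inj₁ (here t≡x)     = inj₂ (here t≡x)
...   | inj₁ (there t∈seen) = inj₁ t∈seen
...   | inj₂ t∈xs           = inj₂ (there t∈xs)

dedup-keeps-seen : ∀ seen xs {t} → t ∈ seen → t ∈ dedup seen xs
dedup-keeps-seen seen []       m = m
dedup-keeps-seen seen (x ∷ xs) m with any (sameTiling x) seen
... | true  = dedup-keeps-seen seen xs m
... | false = dedup-keeps-seen (x ∷ seen) xs (there m)

dedup-represents : ∀ seen xs {x} → x ∈ xs → ∃[ y ] (y ∈ dedup seen xs × T (sameTiling x y))
dedup-represents seen (x ∷ xs) (here refl) with any (sameTiling x) seen in dup
... | true with find (any⁻ (sameTiling x) seen (Equivalence.from T-≡ dup))
...   | y , y∈seen , same = y , dedup-keeps-seen seen xs y∈seen , same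
dedup-represents seen (x ∷ xs) (here refl) | false =
  x , dedup-keeps-seen (x ∷ seen) xs (here refl) , sameTiling-refl x
dedup-represents seen (x ∷ xs) (there m) with any (sameTiling x) seen
... | true  = dedup-represents seen xs m
... | false = dedup-represents (x ∷ seen) xs m

foldr-max : ∀ {X : Set} (f : X → ℕ) xs N → (∀ {x} → x ∈ xs → f x ≤ N) → ∃[ x ] (x ∈ xs × f x ≡ N) →
            foldr (λ x k → f x ⊔ k) 0 xs ≡ N
foldr-max f xs N bounded (x , x∈xs , fx≡N) =
  ≤-antisym (upper xs bounded) (subst (_≤ foldr (λ x k → f x ⊔ k) 0 xs) fx≡N (member x∈xs))
  where
  upper : ∀ ys → (∀ {y} → y ∈ ys → f y ≤ N) → foldr (λ x k → f x ⊔ k) 0 ys ≤ N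
  upper []       _  = z≤n
  upper (y ∷ ys) bd = ⊔-lub (bd (here refl)) (upper ys (bd ∘ there))
  member : ∀ {y ys} → y ∈ ys → f y ≤ foldr (λ x k → f x ⊔ k) 0 ys
  member {y} {z ∷ ys} (here refl) = m≤m⊔n (f y) _
  member {y} {z ∷ ys} (there m)   = ≤-trans (member m) (m≤n⊔m (f z) _)

module Rectangle (A B : ℕ) where
  m n : ℕ
  m = suc A
  n = suc B

  spotsOfWord : List Dir → Tiling
  spotsOfWord = spotsOf 0 m 0 n

  distinct : List Tiling
  distinct = dedup [] (map spotsOfWord (paths m n))

  from-word : ∀ {t} → t ∈ distinct → ∃[ p ] (Word m n p × t ≡ spotsOfWord p)
  from-word t∈D with dedup-⊆ [] (map spotsOfWord (paths m n)) t∈D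
  ... | inj₂ t∈words with ∈-map⁻ spotsOfWord t∈words
  ...   | p , p∈paths , refl = p , word⁻ p∈paths , refl

  -- a maximal tiling has m + n - 1 spotlights: no word is longer, and the longest word survives
  -- deduplication up to a word of the same length
  maxSpots-rect : maxSpots m n ≡ maxLen m n
  maxSpots-rect = trans (cong (foldr (λ t k → length t ⊔ k) 0) (tilings-rect m n))
                        (foldr-max length distinct (maxLen m n) bounded attained)
    where
    bounded : ∀ {t} → t ∈ distinct → length t ≤ maxLen m n
    bounded t∈D with from-word t∈D
    ... | p , w , refl = subst (_≤ maxLen m n) (sym (spots-length w)) (word-length≤ w)
    attained : ∃[ t ] (t ∈ distinct × length t ≡ maxLen m n)
    attained with longest-word A B
    ... | p , w , len with dedup-represents [] (map spotsOfWord (paths m n)) (∈-map⁺ spotsOfWord (word⁺ w))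
    ...   | t , t∈D , same with from-word t∈D
    ...     | q , w' , refl with same-words w w' (same⇒covers _ _ same)
    ...       | inj₁ refl     = t , t∈D , trans (spots-length w) len
    ...       | inj₂ (_ , max) = t , t∈D , trans (spots-length w') max

countᵇ : ∀ {X : Set} → (X → Bool) → List X → ℕ
countᵇ g []       = 0
countᵇ g (x ∷ xs) = if g x then suc (countᵇ g xs) else countᵇ g xs

countᵇ-++ : ∀ {X : Set} (g : X → Bool) xs ys → countᵇ g (xs ++ ys) ≡ countᵇ g xs + countᵇ g ys
countᵇ-++ g []       ys = refl
countᵇ-++ g (x ∷ xs) ys with g x
... | true  = cong suc (countᵇ-++ g xs ys)
... | false = countᵇ-++ g xs ys

countᵇ-map : ∀ {X Y : Set} (g : Y → Bool) (f : X → Y) xs → countᵇ g (map f xs) ≡ countᵇ (g ∘ f) xs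
countᵇ-map g f []       = refl
countᵇ-map g f (x ∷ xs) with g (f x)
... | true  = cong suc (countᵇ-map g f xs)
... | false = countᵇ-map g f xs

countᵇ-cong : ∀ {X : Set} (g h : X → Bool) xs → (∀ {x} → x ∈ xs → g x ≡ h x) → countᵇ g xs ≡ countᵇ h xs
countᵇ-cong g h []       _   = refl
countᵇ-cong g h (x ∷ xs) g≗h rewrite g≗h (here refl) with h x
... | true  = cong suc (countᵇ-cong g h xs (g≗h ∘ there))
... | false = countᵇ-cong g h xs (g≗h ∘ there)

countᵇ-none : ∀ {X : Set} (g : X → Bool) xs → (∀ x → g x ≡ false) → countᵇ g xs ≡ 0
countᵇ-none g []       _     = refl
countᵇ-none g (x ∷ xs) never rewrite never x = countᵇ-none g xs never

coeff-as-count : ∀ (g : Tiling → Bool) xs a b →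
  coeff (map (λ t → (1 , hcount t , vcount t)) (filter (λ t → T? (g t)) xs)) a b ≡
  countᵇ (λ t → g t ∧ ((a ≡ᵇ hcount t) ∧ (b ≡ᵇ vcount t))) xs
coeff-as-count g []       a b = refl
coeff-as-count g (x ∷ xs) a b with g x
... | false = coeff-as-count g xs a b
... | true with (a ≡ᵇ hcount x) ∧ (b ≡ᵇ vcount x)
...   | true  = cong suc (coeff-as-count g xs a b)
...   | false = coeff-as-count g xs a b

module DedupCount (P : Tiling → Bool) where

  Fresh : List Tiling → List Tiling → Set
  Fresh seen []       = ⊤
  Fresh seen (x ∷ xs) = (T (P x) → ∀ {y} → y ∈ seen → ¬ T (sameTiling x y)) × Fresh (x ∷ seen) xs

  fresh-⊆ : ∀ {seen seen'} xs → (∀ {y} → y ∈ seen' → y ∈ seen) → Fresh seen xs → Fresh seen' xs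
  fresh-⊆ []       _   _               = tt
  fresh-⊆ (x ∷ xs) sub (new , fresh) = (λ Px y∈seen' → new Px (sub y∈seen')) , fresh-⊆ xs sub' fresh
    where
    sub' : ∀ {y} → y ∈ x ∷ _ → y ∈ x ∷ _
    sub' (here y≡x)  = here y≡x
    sub' (there y∈s) = there (sub y∈s)

  dedup-count : ∀ seen xs → Fresh seen xs → countᵇ P (dedup seen xs) ≡ countᵇ P seen + countᵇ P xs
  dedup-count seen []       _ = sym (+-identityʳ _)
  dedup-count seen (x ∷ xs) (new , fresh) with any (sameTiling x) seen in dup | P x in Px
  ... | true  | true  with find (any⁻ (sameTiling x) seen (Equivalence.from T-≡ dup))
  ...   | y , y∈seen , same = ⊥-elim (new tt y∈seen same)
  dedup-count seen (x ∷ xs) (new , fresh) | true  | false =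
    dedup-count seen xs (fresh-⊆ xs there fresh)
  dedup-count seen (x ∷ xs) (new , fresh) | false | true
    rewrite dedup-count (x ∷ seen) xs fresh | Px = sym (+-suc (countᵇ P seen) (countᵇ P xs))
  dedup-count seen (x ∷ xs) (new , fresh) | false | false
    rewrite dedup-count (x ∷ seen) xs fresh | Px = refl

  module _ (tilingOf : List Dir → Tiling) (U : List (List Dir))
    (determined : ∀ {p q} → p ∈ U → q ∈ U → T (P (tilingOf p)) →
                  T (sameTiling (tilingOf p) (tilingOf q)) → p ≡ q) where

    fresh-words : ∀ qs ps → (∀ {q} → q ∈ qs → q ∈ U) → (∀ {p} → p ∈ ps → p ∈ U) →
                  Unique ps → (∀ {p} → p ∈ ps → p ∉ qs) → Fresh (map tilingOf qs) (map tilingOf ps)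
    fresh-words qs []       _    _    _                _     = tt
    fresh-words qs (p ∷ ps) qs⊆U ps⊆U (p∉ps ∷ unique) apart =
      new , fresh-words (p ∷ qs) ps (λ { (here refl) → ps⊆U (here refl) ; (there q∈qs) → qs⊆U q∈qs })
                        (ps⊆U ∘ there) unique apart'
      where
      new : T (P (tilingOf p)) → ∀ {y} → y ∈ map tilingOf qs → ¬ T (sameTiling (tilingOf p) y)
      new Pp y∈ same with ∈-map⁻ tilingOf y∈
      ... | q , q∈qs , refl =
        apart (here refl) (subst (_∈ qs) (sym (determined (ps⊆U (here refl)) (qs⊆U q∈qs) Pp same)) q∈qs)
      apart' : ∀ {p'} → p' ∈ ps → p' ∉ p ∷ qs
      apart' p'∈ps (here refl)   = All¬⇒¬Any p∉ps p'∈ps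
      apart' p'∈ps (there p'∈qs) = apart (there p'∈ps) p'∈qs

    fresh-all : Unique U → Fresh [] (map tilingOf U)
    fresh-all unique = fresh-words [] U (λ ()) (λ p∈U → p∈U) unique (λ _ ())

unique-paths : ∀ A B → Unique (paths A B)
unique-paths zero    B       = All.[] ∷ []
unique-paths (suc A) zero    = All.[] ∷ []
unique-paths (suc A) (suc B) =
  Unique.++⁺ (Unique.map⁺ (proj₂ ∘ ∷-injective) (unique-paths A (suc B)))
             (Unique.map⁺ (proj₂ ∘ ∷-injective) (unique-paths (suc A) B)) hor≠ver
  where
  hor≠ver : Disjoint (map (hor ∷_) (paths A (suc B))) (map (ver ∷_) (paths (suc A) B))
  hor≠ver (h , v) with ∈-map⁻ (hor ∷_) h | ∈-map⁻ (ver ∷_) v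
  ... | _ , _ , refl | _ , _ , ()

nonMaximalWith : ℕ → ℕ → ℕ → List Dir → Bool
nonMaximalWith N a b p = (#hor p + #ver p <ᵇ N) ∧ ((a ≡ᵇ #hor p) ∧ (b ≡ᵇ #ver p))

wordCount : ℕ → ℕ → ℕ → ℕ → ℕ
wordCount A B a b = countᵇ (nonMaximalWith (maxLen A B) a b) (paths A B)

atPred : (ℕ → ℕ) → ℕ → ℕ
atPred f zero    = 0
atPred f (suc a) = f a

-- first-letter recursion: a word for a (1 + A) × (1 + B) box starts with hor or ver
wordCount-step : ∀ A B a b → wordCount (suc A) (suc B) a b ≡
  atPred (λ a' → wordCount A (suc B) a' b) a + atPred (λ b' → wordCount (suc A) B a b') b
wordCount-step A B a b =
  trans (countᵇ-++ test (map (hor ∷_) (paths A (suc B))) (map (ver ∷_) (paths (suc A) B)))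
    (cong₂ _+_ (trans (countᵇ-map test (hor ∷_) (paths A (suc B))) (hor-part a))
               (trans (countᵇ-map test (ver ∷_) (paths (suc A) B)) (ver-part b)))
  where
  test = nonMaximalWith (maxLen (suc A) (suc B)) a b
  hor-part : ∀ a → countᵇ (λ p → nonMaximalWith (maxLen (suc A) (suc B)) a b (hor ∷ p)) (paths A (suc B)) ≡
                   atPred (λ a' → wordCount A (suc B) a' b) a
  hor-part zero     = countᵇ-none _ (paths A (suc B)) (λ p → ∧-zeroʳ _)
  hor-part (suc a') = countᵇ-cong _ _ (paths A (suc B)) (λ {p} _ → shorter p)
    where
    shorter : ∀ p → nonMaximalWith (maxLen (suc A) (suc B)) (suc a') b (hor ∷ p) ≡
                    nonMaximalWith (maxLen A (suc B)) a' b p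
    shorter p rewrite +-suc A B = refl
  ver-part : ∀ b → countᵇ (λ p → nonMaximalWith (maxLen (suc A) (suc B)) a b (ver ∷ p)) (paths (suc A) B) ≡
                   atPred (λ b' → wordCount (suc A) B a b') b
  ver-part zero     = countᵇ-none _ (paths (suc A) B)
    (λ p → trans (cong ((#hor p + suc (#ver p) <ᵇ maxLen (suc A) (suc B)) ∧_) (∧-zeroʳ (a ≡ᵇ #hor p))) (∧-zeroʳ _))
  ver-part (suc b') = countᵇ-cong _ _ (paths (suc A) B) (λ {p} _ → shorter p)
    where
    shorter : ∀ p → nonMaximalWith (maxLen (suc A) (suc B)) a (suc b') (ver ∷ p) ≡
                    nonMaximalWith (maxLen (suc A) B) a b' p
    shorter p rewrite +-suc (#hor p) (#ver p) | +-suc A B = refl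

guard₂ : Bool → Bool → ℕ → ℕ
guard₂ X Y n = if X then (if Y then n else 0) else 0

guard₂-false : ∀ X n → guard₂ X false n ≡ 0
guard₂-false true  n = refl
guard₂-false false n = refl

guard₂-+ : ∀ X Y m n → guard₂ X Y (m + n) ≡ guard₂ X Y m + guard₂ X Y n
guard₂-+ true  true  m n = refl
guard₂-+ true  false m n = refl
guard₂-+ false Y     m n = refl

-- the coefficient of H^a V^b on the right-hand side, for m = 1 + A and n = 1 + B
closedForm : ℕ → ℕ → ℕ → ℕ → ℕ
closedForm A B a b = guard₂ (a ≡ᵇ suc A) (b <ᵇ B) ((b + A) C A) + guard₂ (b ≡ᵇ suc B) (a <ᵇ A) ((a + B) C B)

pascal-row : ∀ b A → (suc b + A) C A + (b + suc A) C suc A ≡ (suc b + suc A) C suc A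
pascal-row b A rewrite +-suc b A = nCk+nC[k+1]≡[n+1]C[k+1] (suc (b + A)) A

pascal-col : ∀ a B → (a + suc B) C suc B + (suc a + B) C B ≡ (suc a + suc B) C suc B
pascal-col a B = trans (+-comm ((a + suc B) C suc B) ((suc a + B) C B)) (pascal-row a B)

-- away from the boundary the closed form satisfies the first-letter recursion,
-- by Pascal's rule in each of its two terms
closedForm-step : ∀ A B a b → closedForm (suc A) (suc B) (suc a) (suc b) ≡
                              closedForm A (suc B) a (suc b) + closedForm (suc A) B (suc a) b
closedForm-step A B a b = sym (begin
  (row₁ + col₁) + (row₂ + col₂)                   ≡⟨ interchange row₁ col₁ row₂ col₂ ⟩
  (row₁ + row₂) + (col₁ + col₂)                   ≡⟨ cong₂ _+_ (guard₂-+ X Y _ _) (guard₂-+ Z W _ _) ⟨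
  guard₂ X Y ((suc b + A) C A + (b + suc A) C suc A) +
  guard₂ Z W ((a + suc B) C suc B + (suc a + B) C B) ≡⟨ cong₂ _+_ (cong (guard₂ X Y) (pascal-row b A))
                                                                  (cong (guard₂ Z W) (pascal-col a B)) ⟩
  closedForm (suc A) (suc B) (suc a) (suc b)        ∎)
  where
  open ≡-Reasoning
  X = a ≡ᵇ suc A
  Y = b <ᵇ B
  Z = b ≡ᵇ suc B
  W = a <ᵇ A
  row₁ = guard₂ X Y ((suc b + A) C A)
  row₂ = guard₂ X Y ((b + suc A) C suc A)
  col₁ = guard₂ Z W ((a + suc B) C suc B)
  col₂ = guard₂ Z W ((suc a + B) C B)

-- hence wordCount equals the closed form: the boundary cases are computed directly
wordCount≡closedForm : ∀ A B a b → wordCount (suc A) (suc B) a b ≡ closedForm A B a b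
wordCount≡closedForm A B zero zero rewrite wordCount-step A B 0 0 = refl
wordCount≡closedForm A zero zero (suc b') rewrite wordCount-step A 0 0 (suc b') | +-identityʳ A
  with b' ≡ᵇ 0 | 0 <ᵇ A
... | true  | true  = refl
... | true  | false = refl
... | false | true  = refl
... | false | false = refl
wordCount≡closedForm A (suc B) zero (suc b')
  rewrite wordCount-step A (suc B) 0 (suc b') | wordCount≡closedForm A B 0 b' | nCn≡1 B | nCn≡1 (suc B) = refl
wordCount≡closedForm zero B (suc a') zero rewrite wordCount-step 0 B (suc a') 0
  with a' ≡ᵇ 0 | 0 <ᵇ B
... | true  | true  = refl
... | true  | false = refl
... | false | true  = refl
... | false | false = refl
wordCount≡closedForm (suc A) B (suc a') zero
  rewrite wordCount-step (suc A) B (suc a') 0 | wordCount≡closedForm A B a' 0 | nCn≡1 A | nCn≡1 (suc A) =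
  +-identityʳ _
wordCount≡closedForm zero zero (suc a') (suc b')
  rewrite wordCount-step 0 0 (suc a') (suc b')
        | guard₂-false (a' ≡ᵇ 0) ((suc b' + 0) C 0) | guard₂-false (b' ≡ᵇ 0) ((suc a' + 0) C 0) = refl
wordCount≡closedForm zero (suc B) (suc a') (suc b')
  rewrite wordCount-step 0 (suc B) (suc a') (suc b') | ∧-zeroʳ (a' ≡ᵇ 0)
        | wordCount≡closedForm 0 B (suc a') b' | guard₂-false (b' ≡ᵇ suc B) ((suc a' + B) C B) = refl
wordCount≡closedForm (suc A) zero (suc a') (suc b')
  rewrite wordCount-step (suc A) 0 (suc a') (suc b') | wordCount≡closedForm A 0 a' (suc b')
        | guard₂-false (a' ≡ᵇ suc A) ((suc b' + A) C A) = +-identityʳ _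
wordCount≡closedForm (suc A) (suc B) (suc a') (suc b')
  rewrite wordCount-step (suc A) (suc B) (suc a') (suc b')
        | wordCount≡closedForm A (suc B) a' (suc b') | wordCount≡closedForm (suc A) B (suc a') b' =
  sym (closedForm-step A B a' b')

map-applyUpTo : ∀ {X : Set} (g : ℕ → X) (f : ℕ → ℕ) k → map g (applyUpTo f k) ≡ applyUpTo (g ∘ f) k
map-applyUpTo g f zero    = refl
map-applyUpTo g f (suc k) = cong (g (f 0) ∷_) (map-applyUpTo g (f ∘ suc) k)

sum-zero : ∀ (h : ℕ → ℕ) k → (∀ r → h r ≡ 0) → sum (applyUpTo h k) ≡ 0
sum-zero h zero    _    = refl
sum-zero h (suc k) vanishes rewrite vanishes 0 = sum-zero (h ∘ suc) k (vanishes ∘ suc)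

sum-single : ∀ k (h : ℕ → ℕ) c → (∀ r → r ≢ c → h r ≡ 0) → sum (applyUpTo h k) ≡ (if c <ᵇ k then h c else 0)
sum-single zero    h c       _       = refl
sum-single (suc k) h zero    support rewrite sum-zero (h ∘ suc) k (λ r → support (suc r) (λ ())) = +-identityʳ (h 0)
sum-single (suc k) h (suc c) support rewrite support 0 (λ ()) =
  sum-single k (h ∘ suc) c (λ r r≢c → support (suc r) (r≢c ∘ suc-injective))

coeff-++ : ∀ P Q a b → coeff (P ++ Q) a b ≡ coeff P a b + coeff Q a b
coeff-++ []      Q a b = refl
coeff-++ (x ∷ P) Q a b = trans (cong (_ +_) (coeff-++ P Q a b)) (sym (+-assoc _ (coeff P a b) (coeff Q a b)))

swap-guards : ∀ X Y n → (if Y then (if X then n else 0) else 0) ≡ guard₂ X Y n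
swap-guards true  true  n = refl
swap-guards true  false n = refl
swap-guards false true  n = refl
swap-guards false false n = refl

coeff-RHS : ∀ A B a b → coeff (RHS (suc A) (suc B)) a b ≡ closedForm A B a b
coeff-RHS A B a b = trans (coeff-++ (map term₁ (upTo B)) (map term₂ (upTo A)) a b) (cong₂ _+_ first second)
  where
  term₁ term₂ : ℕ → ℕ × ℕ × ℕ
  term₁ r = ((r + A) C A , suc A , r)
  term₂ r = ((r + B) C B , r , suc B)
  first : coeff (map term₁ (upTo B)) a b ≡ guard₂ (a ≡ᵇ suc A) (b <ᵇ B) ((b + A) C A)
  first = begin
    coeff (map term₁ (upTo B)) a b
      ≡⟨ cong sum (trans (sym (map-∘ (upTo B))) (map-applyUpTo _ (λ r → r) B)) ⟩
    sum (applyUpTo (λ r → if (a ≡ᵇ suc A) ∧ (b ≡ᵇ r) then (r + A) C A else 0) B)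
      ≡⟨ sum-single B _ b (λ r r≢b → cong (λ t → if t then (r + A) C A else 0)
                            (trans (cong ((a ≡ᵇ suc A) ∧_) (≢⇒≡ᵇ-false (r≢b ∘ sym))) (∧-zeroʳ _))) ⟩
    (if b <ᵇ B then (if (a ≡ᵇ suc A) ∧ (b ≡ᵇ b) then (b + A) C A else 0) else 0)
      ≡⟨ cong (λ t → if b <ᵇ B then (if (a ≡ᵇ suc A) ∧ t then (b + A) C A else 0) else 0) (≡ᵇ-refl b) ⟩
    (if b <ᵇ B then (if (a ≡ᵇ suc A) ∧ true then (b + A) C A else 0) else 0)
      ≡⟨ cong (λ t → if b <ᵇ B then (if t then (b + A) C A else 0) else 0) (∧-identityʳ (a ≡ᵇ suc A)) ⟩
    (if b <ᵇ B then (if a ≡ᵇ suc A then (b + A) C A else 0) else 0)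
      ≡⟨ swap-guards (a ≡ᵇ suc A) (b <ᵇ B) _ ⟩
    guard₂ (a ≡ᵇ suc A) (b <ᵇ B) ((b + A) C A)
      ∎
    where open ≡-Reasoning
  second : coeff (map term₂ (upTo A)) a b ≡ guard₂ (b ≡ᵇ suc B) (a <ᵇ A) ((a + B) C B)
  second = begin
    coeff (map term₂ (upTo A)) a b
      ≡⟨ cong sum (trans (sym (map-∘ (upTo A))) (map-applyUpTo _ (λ r → r) A)) ⟩
    sum (applyUpTo (λ r → if (a ≡ᵇ r) ∧ (b ≡ᵇ suc B) then (r + B) C B else 0) A)
      ≡⟨ sum-single A _ a (λ r r≢a → cong (λ t → if t ∧ (b ≡ᵇ suc B) then (r + B) C B else 0)
                            (≢⇒≡ᵇ-false (r≢a ∘ sym))) ⟩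
    (if a <ᵇ A then (if (a ≡ᵇ a) ∧ (b ≡ᵇ suc B) then (a + B) C B else 0) else 0)
      ≡⟨ cong (λ t → if a <ᵇ A then (if t ∧ (b ≡ᵇ suc B) then (a + B) C B else 0) else 0) (≡ᵇ-refl a) ⟩
    (if a <ᵇ A then (if b ≡ᵇ suc B then (a + B) C B else 0) else 0)
      ≡⟨ swap-guards (b ≡ᵇ suc B) (a <ᵇ A) _ ⟩
    guard₂ (b ≡ᵇ suc B) (a <ᵇ A) ((a + B) C B)
      ∎
    where open ≡-Reasoning

module RectangleCount (A B a b : ℕ) where
  open Rectangle A B

  counted : Tiling → Bool
  counted t = (length t <ᵇ maxSpots m n) ∧ ((a ≡ᵇ hcount t) ∧ (b ≡ᵇ vcount t))

  counted-word : ∀ {p} → Word m n p → counted (spotsOfWord p) ≡ nonMaximalWith (maxLen m n) a b p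
  counted-word {p} w
    rewrite spots-length {0} {m} {0} {n} w | spots-hcount {0} {m} {0} {n} w | spots-vcount {0} {m} {0} {n} w
          | maxSpots-rect | length≡#hor+#ver p = refl

  -- a counted tiling is not maximal, so it comes from a single word
  determined : ∀ {p q} → p ∈ paths m n → q ∈ paths m n → T (counted (spotsOfWord p)) →
               T (sameTiling (spotsOfWord p) (spotsOfWord q)) → p ≡ q
  determined {p} p∈ q∈ is-counted same with same-words (word⁻ p∈) (word⁻ q∈) (same⇒covers _ _ same)
  ... | inj₁ p≡q       = p≡q
  ... | inj₂ (max , _) = ⊥-elim (<-irrefl max shorter)
    where
    shorter : length p < maxLen m n
    shorter = subst₂ _<_ (spots-length (word⁻ p∈)) maxSpots-rect
                     (<ᵇ⇒< _ _ (proj₁ (Equivalence.to T-∧ is-counted)))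

  -- deduplication keeps every counted tiling, so counted tilings and counted words agree
  count-counted : countᵇ counted (tilings (rect m n)) ≡ wordCount m n a b
  count-counted = begin
    countᵇ counted (tilings (rect m n))
      ≡⟨ cong (countᵇ counted) (tilings-rect m n) ⟩
    countᵇ counted distinct
      ≡⟨ dedup-count [] (map spotsOfWord (paths m n))
                     (fresh-all spotsOfWord (paths m n) determined (unique-paths m n)) ⟩
    countᵇ counted (map spotsOfWord (paths m n))
      ≡⟨ countᵇ-map counted spotsOfWord (paths m n) ⟩
    countᵇ (counted ∘ spotsOfWord) (paths m n)
      ≡⟨ countᵇ-cong _ _ (paths m n) (counted-word ∘ word⁻) ⟩
    wordCount m n a b
      ∎
    where
    open ≡-Reasoning
    open DedupCount counted

theorem3p11 : (m n : ℕ) → 1 ≤ m → 1 ≤ n → ¬ (m ≡ 1 × n ≡ 1) → (a b : ℕ) → coeff (G m n) a b ≡ coeff (RHS m n) a b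
theorem3p11 (suc A) (suc B) _ _ _ a b = begin
  coeff (G (suc A) (suc B)) a b
    ≡⟨ coeff-as-count (λ t → length t <ᵇ maxSpots (suc A) (suc B)) (tilings (rect (suc A) (suc B))) a b ⟩
  countᵇ counted (tilings (rect (suc A) (suc B)))
    ≡⟨ count-counted ⟩
  wordCount (suc A) (suc B) a b
    ≡⟨ wordCount≡closedForm A B a b ⟩
  closedForm A B a b
    ≡⟨ coeff-RHS A B a b ⟨
  coeff (RHS (suc A) (suc B)) a b
    ∎
  where
  open ≡-Reasoning
  open RectangleCount A B a b
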